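{- Let $L$ be a finite lattice with minimum $\hat{0}$, let $r : L \to \mathbb{R}$ be an arbitrary function, let $n \in \mathbb{R}$, and let $t$ be an indeterminate. If $x \in L$ is a left-modular element, then $$\sum_{y \in L} \mu(y)\, t^{n - r(y)} = \sum_{b \in L:\ b \wedge x = \hat{0}} \mu(b) \sum_{y \in [b, b \vee x]} \mu(b,y)\, t^{n - r(y)}.$$
   Context: $\mu$ denotes the Möbius function of $L$ and $\mu(y) = \mu(\hat{0}, y)$. An element $x$ of $L$ is left-modular if for all $y, z \in L$ with $z < y$ one has $z \vee (x \wedge y) = (z \vee x) \wedge y$. -}

module Defs where

open import Level using (0ℓ)
open import Data.Integer using (ℤ; 0ℤ; 1ℤ; _+_; _*_; -_)
open import Data.List using (List; []; _∷_; length)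
open import Data.Nat using (ℕ; zero; suc)
open import Data.Product using (_×_; _,_)
open import Relation.Nullary using (Dec; yes; no; ¬_)
open import Relation.Nullary.Decidable using (_×-dec_)
open import Relation.Binary using (Decidable)
open import Relation.Binary.Lattice using (Lattice)
import Data.List.Membership.Setoid as SetoidMembership
import Data.List.Relation.Unary.Unique.Setoid as SetoidUnique

-- Finiteness: an explicit duplicate-free (up to the lattice equality)
-- list of all elements.  The order is decidable (automatic for a finite
-- lattice classically; needed to compute Möbius functions / sums).
record FiniteLattice : Set₁ where
  field
    lattice : Lattice 0ℓ 0ℓ 0ℓ
  open Lattice lattice public
  open SetoidMembership setoid using (_∈_)
  field
    _≤?_     : Decidable _≤_
    elems    : List Carrier
    complete : ∀ x → x ∈ elems
    unique   : SetoidUnique.Unique setoid elems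
    0̂        : Carrier
    0̂-min    : ∀ x → 0̂ ≤ x

⟦_⟧ : ∀ {p} {P : Set p} → Dec P → ℤ
⟦ yes _ ⟧ = 1ℤ
⟦ no _ ⟧  = 0ℤ

module FinLat (L : FiniteLattice) where
  open FiniteLattice L

  _≈?_ : ∀ x y → Dec (x ≤ y × y ≤ x)
  x ≈? y = (x ≤? y) ×-dec (y ≤? x)

  sumList : List Carrier → (Carrier → ℤ) → ℤ
  sumList []       f = 0ℤ
  sumList (a ∷ as) f = f a + sumList as f

  ΣL : (Carrier → ℤ) → ℤ
  ΣL f = sumList elems f

  -- Möbius function μ(a,b), via the standard recursion
  --   μ(a,a) = 1,  μ(a,b) = - Σ_{a ≤ z < b} μ(a,z) for a < b,  μ(a,b) = 0 if a ≰ b,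
  -- computed with fuel; fuel |L| suffices since chains in L have < |L| steps.
  μ-fuel : ℕ → Carrier → Carrier → ℤ
  μ-fuel zero    a b = 0ℤ
  μ-fuel (suc k) a b with a ≤? b | b ≤? a
  ... | no  _ | _     = 0ℤ
  ... | yes _ | yes _ = 1ℤ
  ... | yes _ | no  _ =
    - ΣL (λ z → ⟦ (a ≤? z) ×-dec (z ≤? b) ⟧ * ((1ℤ + - ⟦ b ≤? z ⟧) * μ-fuel k a z))

  μ₂ : Carrier → Carrier → ℤ
  μ₂ a b = μ-fuel (length elems) a b

  μ : Carrier → ℤ
  μ y = μ₂ 0̂ y

  LeftModular : Carrier → Set
  LeftModular x = ∀ y z → z ≤ y → ¬ (z ≈ y) → (z ∨ (x ∧ y)) ≈ ((z ∨ x) ∧ y)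

{-# OPTIONS --safe #-}
-- It suffices to show, for every y, that μ(y) = Σ { μ(b) μ(b,y) | b ∧ x = 0̂, b ≤ y ≤ b ∨ x }:
-- multiplying by the coefficient of t^(n - r(y)) and summing over y gives the theorem. If x ∧ y = 0̂, left-modularity gives
-- y ≤ b ∨ (x ∧ y) = b, so only b = y contributes. Otherwise expand μ(y) = -Σ_{c<y} μ(c),
-- apply the induction hypothesis and exchange the sums. For fixed b the inner sum runs over
-- c ∈ [b, b ∨ x] with c < y: that is [b, y) if y ≤ b ∨ x, giving -μ(b,y), and otherwise
-- all of [b, (b ∨ x) ∧ y], giving 0: b < (b ∨ x) ∧ y, since x ∧ y ≠ 0̂ lies below (b ∨ x) ∧ y
-- but not below b.
module Submission where

open import Defs
open import Level using (0ℓ)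
open import Algebra.Bundles using (AbelianGroup)
open import Data.Integer using (ℤ; 0ℤ; 1ℤ; -1ℤ; _+_; _*_; -_)
import Data.Integer.Properties as ℤ
open import Data.Integer.Solver using (module +-*-Solver)
open import Data.List using ([]; _∷_; length; filter)
open import Data.List.Properties using (filter-notAll)
open import Data.List.Relation.Unary.All using (All; []; _∷_)
import Data.List.Relation.Unary.All as ListAll
open import Data.List.Relation.Unary.All.Properties using (All¬⇒¬Any)
open import Data.List.Relation.Unary.AllPairs using (_∷_)
open import Data.List.Relation.Unary.Unique.Setoid using (Unique)
open import Data.List.Relation.Unary.Any using (Any; here; there)
import Data.List.Relation.Unary.Any as Any
import Data.Nat as ℕ
import Data.Nat.Properties as ℕ
open import Data.Nat.Induction using () renaming (<-wellFounded to ℕ-<-wellFounded)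
open import Data.Product using (_×_; _,_; proj₁; proj₂)
open import Function using (_∘_)
import Induction.WellFounded as WF
open import Relation.Binary using (Rel; Decidable)
import Relation.Binary.Construct.On as On
open import Relation.Binary.PropositionalEquality using (_≡_; refl; sym; trans; cong; cong₂; module ≡-Reasoning)
open import Relation.Nullary using (Dec; yes; no; ¬_; contradiction)
open import Relation.Nullary.Decidable using (_×-dec_; ¬?)
open import Relation.Unary as U using (Pred)

open +-*-Solver using (solve; con; _:+_; _:*_; :-_; _:=_)

module _ {a p q} {A : Set a} {P : Pred A p} {Q : Pred A q}
         (P? : U.Decidable P) (Q? : U.Decidable Q)
         (P⇒Q : ∀ {z} → P z → Q z) where

  length-filter-mono-≤ : ∀ xs → length (filter P? xs) ℕ.≤ length (filter Q? xs)
  length-filter-mono-≤ []       = ℕ.z≤n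
  length-filter-mono-≤ (z ∷ zs) with P? z | Q? z
  ... | yes _  | yes _  = ℕ.s≤s (length-filter-mono-≤ zs)
  ... | yes pz | no ¬qz = contradiction (P⇒Q pz) ¬qz
  ... | no _   | yes _  = ℕ.m≤n⇒m≤1+n (length-filter-mono-≤ zs)
  ... | no _   | no _   = length-filter-mono-≤ zs

  length-filter-mono-< : ∀ {xs} → Any (λ z → Q z × ¬ P z) xs
                       → length (filter P? xs) ℕ.< length (filter Q? xs)
  length-filter-mono-< {z ∷ zs} (here (qz , ¬pz)) with P? z | Q? z
  ... | yes pz | _      = contradiction pz ¬pz
  ... | no _   | yes _  = ℕ.s≤s (length-filter-mono-≤ zs)
  ... | no _   | no ¬qz = contradiction qz ¬qz
  length-filter-mono-< {z ∷ zs} (there w) with P? z | Q? z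
  ... | yes _  | yes _  = ℕ.s≤s (length-filter-mono-< w)
  ... | yes pz | no ¬qz = contradiction (P⇒Q pz) ¬qz
  ... | no _   | yes _  = ℕ.m≤n⇒m≤1+n (length-filter-mono-< w)
  ... | no _   | no _   = length-filter-mono-< w

module _ {p} {P : Set p} where

  ⟦⟧-yes : (P? : Dec P) → P → ⟦ P? ⟧ ≡ 1ℤ
  ⟦⟧-yes (yes _) _  = refl
  ⟦⟧-yes (no ¬p) p  = contradiction p ¬p

  ⟦⟧-no : (P? : Dec P) → ¬ P → ⟦ P? ⟧ ≡ 0ℤ
  ⟦⟧-no (yes p) ¬p = contradiction p ¬p
  ⟦⟧-no (no _)  _  = refl

  ⟦⟧-¬ : (P? : Dec P) → ⟦ ¬? P? ⟧ ≡ 1ℤ + - ⟦ P? ⟧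
  ⟦⟧-¬ (yes _) = refl
  ⟦⟧-¬ (no _)  = refl

  ⟦⟧*-cong : (P? : Dec P) {m n : ℤ} → (P → m ≡ n) → ⟦ P? ⟧ * m ≡ ⟦ P? ⟧ * n
  ⟦⟧*-cong (yes p) m≡n = cong (1ℤ *_) (m≡n p)
  ⟦⟧*-cong (no _)  _   = refl

module _ {p q} {P : Set p} {Q : Set q} where

  ⟦⟧-cong : (P? : Dec P) (Q? : Dec Q) → (P → Q) → (Q → P) → ⟦ P? ⟧ ≡ ⟦ Q? ⟧
  ⟦⟧-cong (yes _) (yes _) _ _ = refl
  ⟦⟧-cong (no _)  (no _)  _ _ = refl
  ⟦⟧-cong (yes p) (no ¬q) f _ = contradiction (f p) ¬q
  ⟦⟧-cong (no ¬p) (yes q) _ g = contradiction (g q) ¬p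

  ⟦⟧-× : (P? : Dec P) (Q? : Dec Q) → ⟦ P? ×-dec Q? ⟧ ≡ ⟦ P? ⟧ * ⟦ Q? ⟧
  ⟦⟧-× (yes _) (yes _) = refl
  ⟦⟧-× (yes _) (no _)  = refl
  ⟦⟧-× (no _)  (yes _) = refl
  ⟦⟧-× (no _)  (no _)  = refl

module _ (L : FiniteLattice) where
  open FiniteLattice L renaming (refl to ≤-refl; trans to ≤-trans)
  open FinLat L

  sumList-cong : ∀ xs {f g : Carrier → ℤ} → (∀ z → f z ≡ g z) → sumList xs f ≡ sumList xs g
  sumList-cong []       _    = refl
  sumList-cong (z ∷ zs) f≡g = cong₂ _+_ (f≡g z) (sumList-cong zs f≡g)

  sumList-zero : ∀ xs {f : Carrier → ℤ} → All (λ z → f z ≡ 0ℤ) xs → sumList xs f ≡ 0ℤ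
  sumList-zero []       []             = refl
  sumList-zero (z ∷ zs) (fz≡0 ∷ fzs≡0) = cong₂ _+_ fz≡0 (sumList-zero zs fzs≡0)

  sumList-+ : ∀ xs (f g : Carrier → ℤ) → sumList xs (λ z → f z + g z) ≡ sumList xs f + sumList xs g
  sumList-+ []       f g = refl
  sumList-+ (z ∷ zs) f g = trans (cong (f z + g z +_) (sumList-+ zs f g))
    (solve 4 (λ a b c d → (a :+ b) :+ (c :+ d) := (a :+ c) :+ (b :+ d)) refl
      (f z) (g z) (sumList zs f) (sumList zs g))

  sumList-*ˡ : ∀ xs k (f : Carrier → ℤ) → sumList xs (λ z → k * f z) ≡ k * sumList xs f
  sumList-*ˡ []       k f = sym (ℤ.*-zeroʳ k)
  sumList-*ˡ (z ∷ zs) k f = trans (cong (k * f z +_) (sumList-*ˡ zs k f))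
    (sym (ℤ.*-distribˡ-+ k (f z) (sumList zs f)))

  sumList-swap : ∀ xs ys (F : Carrier → Carrier → ℤ)
               → sumList xs (λ c → sumList ys (F c)) ≡ sumList ys (λ b → sumList xs (λ c → F c b))
  sumList-swap []       ys F = sym (sumList-zero ys (ListAll.tabulate λ _ → refl))
  sumList-swap (c ∷ cs) ys F = trans (cong (sumList ys (F c) +_) (sumList-swap cs ys F))
    (sym (sumList-+ ys (F c) (λ b → sumList cs (λ c′ → F c′ b))))

  ΣL[_]_ : ∀ {p} {P : Pred Carrier p} → U.Decidable P → (Carrier → ℤ) → ℤ
  ΣL[ P? ] f = ΣL (λ z → ⟦ P? z ⟧ * f z)

  module _ {p} {P : Pred Carrier p} (P? : U.Decidable P) where

    ΣL[]-congʳ : ∀ {f g} → (∀ {z} → P z → f z ≡ g z) → ΣL[ P? ] f ≡ ΣL[ P? ] g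
    ΣL[]-congʳ f≡g = sumList-cong elems (λ z → ⟦⟧*-cong (P? z) f≡g)

    ΣL[]-*ˡ : ∀ k f → ΣL[ P? ] (λ z → k * f z) ≡ k * ΣL[ P? ] f
    ΣL[]-*ˡ k f = trans (sumList-cong elems (λ z → solve 3 (λ i k v → i :* (k :* v) := k :* (i :* v)) refl
                                                      ⟦ P? z ⟧ k (f z)))
                        (sumList-*ˡ elems k _)

    ΣL[]-*ʳ : ∀ f k → ΣL[ P? ] f * k ≡ ΣL[ P? ] (λ z → f z * k)
    ΣL[]-*ʳ f k = trans (ℤ.*-comm (ΣL[ P? ] f) k)
      (trans (sym (ΣL[]-*ˡ k f)) (ΣL[]-congʳ (λ {z} _ → ℤ.*-comm k (f z))))

    ΣL[]-neg : ∀ f → ΣL[ P? ] (λ z → - f z) ≡ - ΣL[ P? ] f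
    ΣL[]-neg f = trans (ΣL[]-congʳ (λ {z} _ → sym (ℤ.-1*i≡-i (f z))))
                       (trans (ΣL[]-*ˡ -1ℤ f) (ℤ.-1*i≡-i (ΣL[ P? ] f)))

    ΣL-ΣL[]-swap : (F : Carrier → Carrier → ℤ) → ΣL (λ c → ΣL[ P? ] (F c)) ≡ ΣL[ P? ] (λ b → ΣL (λ c → F c b))
    ΣL-ΣL[]-swap F = trans (sumList-swap elems elems (λ c b → ⟦ P? b ⟧ * F c b))
                           (sumList-cong elems (λ b → sumList-*ˡ elems ⟦ P? b ⟧ (λ c → F c b)))

    ΣL[]-empty : (∀ z → ¬ P z) → ∀ f → ΣL[ P? ] f ≡ 0ℤ
    ΣL[]-empty ¬P f = sumList-zero elems (ListAll.tabulate λ {z} _ → cong (_* f z) (⟦⟧-no (P? z) (¬P z)))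

    ΣL[]-unique : ∀ {w} → (∀ {z} → P z → z ≈ w) → (∀ {z} → z ≈ w → P z)
                → ∀ f → (∀ {z} → z ≈ w → f z ≡ f w) → ΣL[ P? ] f ≡ f w
    ΣL[]-unique {w} P⇒≈w ≈w⇒P f f-resp = go unique (complete w)
      where
      go : ∀ {xs} → Unique setoid xs → Any (w ≈_) xs → sumList xs (λ z → ⟦ P? z ⟧ * f z) ≡ f w
      go {z ∷ zs} (z≉zs ∷ _) (here w≈z) =
        begin
          ⟦ P? z ⟧ * f z + sumList zs (λ c → ⟦ P? c ⟧ * f c)
        ≡⟨ cong₂ _+_ (cong₂ _*_ (⟦⟧-yes (P? z) (≈w⇒P (Eq.sym w≈z))) (f-resp (Eq.sym w≈z)))
                     (sumList-zero zs (ListAll.map (λ {c} z≉c → cong (_* f c) (⟦⟧-no (P? c)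
                        (λ pc → z≉c (Eq.trans (Eq.sym w≈z) (Eq.sym (P⇒≈w pc)))))) z≉zs)) ⟩
          1ℤ * f w + 0ℤ
        ≡⟨ trans (ℤ.+-identityʳ _) (ℤ.*-identityˡ (f w)) ⟩
          f w
        ∎
        where open ≡-Reasoning
      go {z ∷ zs} (z≉zs ∷ zs-unique) (there w∈zs) =
        trans (cong (_+ sumList zs (λ c → ⟦ P? c ⟧ * f c)) (cong (_* f z) (⟦⟧-no (P? z) ¬pz)))
              (trans (ℤ.+-identityˡ _) (go zs-unique w∈zs))
        where
        ¬pz : ¬ P z
        ¬pz pz = All¬⇒¬Any z≉zs (Any.map (Eq.trans (P⇒≈w pz)) w∈zs)

  module _ {p q} {P : Pred Carrier p} {Q : Pred Carrier q}
           (P? : U.Decidable P) (Q? : U.Decidable Q) where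

    ΣL[]-congˡ : (∀ {z} → P z → Q z) → (∀ {z} → Q z → P z) → ∀ f → ΣL[ P? ] f ≡ ΣL[ Q? ] f
    ΣL[]-congˡ P⇒Q Q⇒P f = sumList-cong elems (λ z → cong (_* f z) (⟦⟧-cong (P? z) (Q? z) P⇒Q Q⇒P))

    ΣL[]-× : ∀ f → ΣL[ P? ] (λ z → ⟦ Q? z ⟧ * f z) ≡ ΣL[ (λ z → P? z ×-dec Q? z) ] f
    ΣL[]-× f = sumList-cong elems λ z → trans (sym (ℤ.*-assoc ⟦ P? z ⟧ ⟦ Q? z ⟧ (f z)))
                                              (cong (_* f z) (sym (⟦⟧-× (P? z) (Q? z))))

    ΣL[]-split : ∀ f → ΣL[ P? ] f ≡ ΣL[ (λ z → P? z ×-dec ¬? (Q? z)) ] f + ΣL[ (λ z → P? z ×-dec Q? z) ] f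
    ΣL[]-split f = trans (sumList-cong elems split) (sumList-+ elems _ _)
      where
      split : ∀ z → ⟦ P? z ⟧ * f z ≡ ⟦ P? z ×-dec ¬? (Q? z) ⟧ * f z + ⟦ P? z ×-dec Q? z ⟧ * f z
      split z rewrite ⟦⟧-× (P? z) (¬? (Q? z)) | ⟦⟧-¬ (Q? z) | ⟦⟧-× (P? z) (Q? z) =
        solve 3 (λ p q v → p :* v := (p :* (con 1ℤ :+ :- q)) :* v :+ (p :* q) :* v) refl
          ⟦ P? z ⟧ ⟦ Q? z ⟧ (f z)

    ΣL[]-swap : (F : Carrier → Carrier → ℤ)
              → ΣL[ P? ] (λ c → ΣL[ Q? ] (F c)) ≡ ΣL[ Q? ] (λ b → ΣL[ P? ] (λ c → F c b))
    ΣL[]-swap F = trans (sumList-cong elems (λ c → sym (ΣL[]-*ˡ Q? ⟦ P? c ⟧ (F c))))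
                        (ΣL-ΣL[]-swap Q? (λ c b → ⟦ P? c ⟧ * F c b))

  _<_ : Rel Carrier 0ℓ
  a < b = a ≤ b × ¬ b ≤ a

  _<?_ : Decidable _<_
  a <? b = (a ≤? b) ×-dec ¬? (b ≤? a)

  Icc : Carrier → Carrier → Pred Carrier 0ℓ
  Icc a b z = a ≤ z × z ≤ b

  Icc? : ∀ a b → U.Decidable (Icc a b)
  Icc? a b z = (a ≤? z) ×-dec (z ≤? b)

  Ico : Carrier → Carrier → Pred Carrier 0ℓ
  Ico a b z = a ≤ z × z < b

  Ico? : ∀ a b → U.Decidable (Ico a b)
  Ico? a b z = (a ≤? z) ×-dec (z <? b)

  #below : Carrier → ℕ.ℕ
  #below b = length (filter (_<? b) elems)

  #below-mono : ∀ {a b} → a < b → #below a ℕ.< #below b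
  #below-mono {a} {b} (a≤b , b≰a) = length-filter-mono-< (_<? a) (_<? b)
    (λ (z≤a , a≰z) → ≤-trans z≤a a≤b , λ b≤z → a≰z (≤-trans a≤b b≤z))
    (Any.map (λ a≈z → (≤-trans (reflexive (Eq.sym a≈z)) a≤b , λ b≤z → b≰a (≤-trans b≤z (reflexive (Eq.sym a≈z))))
                     , λ (_ , a≰z) → a≰z (reflexive a≈z))
             (complete a))

  #below<length : ∀ b → #below b ℕ.< length elems
  #below<length b = filter-notAll (_<? b) elems (Any.map (λ b≈z (_ , b≰z) → b≰z (reflexive b≈z)) (complete b))

  <-wellFounded : WF.WellFounded _<_
  <-wellFounded = WF.Subrelation.wellFounded #below-mono (On.wellFounded #below ℕ-<-wellFounded)

  μ-fuel-≰ : ∀ k {a b} → ¬ a ≤ b → μ-fuel (ℕ.suc k) a b ≡ 0ℤ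
  μ-fuel-≰ k {a} {b} a≰b with a ≤? b
  ... | yes a≤b = contradiction a≤b a≰b
  ... | no _    = refl

  μ-fuel-≈ : ∀ k {a b} → a ≤ b → b ≤ a → μ-fuel (ℕ.suc k) a b ≡ 1ℤ
  μ-fuel-≈ k {a} {b} a≤b b≤a with a ≤? b | b ≤? a
  ... | yes _   | yes _   = refl
  ... | yes _   | no b≰a  = contradiction b≤a b≰a
  ... | no a≰b  | _       = contradiction a≤b a≰b

  μ-fuel-< : ∀ k {a b} → a < b → μ-fuel (ℕ.suc k) a b ≡ - ΣL[ Ico? a b ] (μ-fuel k a)
  μ-fuel-< k {a} {b} (a≤b , b≰a) with a ≤? b | b ≤? a
  ... | yes _  | no _   = cong -_ (sumList-cong elems guard)
    where
    guard : ∀ z → ⟦ Icc? a b z ⟧ * ((1ℤ + - ⟦ b ≤? z ⟧) * μ-fuel k a z) ≡ ⟦ Ico? a b z ⟧ * μ-fuel k a z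
    guard z rewrite ⟦⟧-× (a ≤? z) (z <? b) | ⟦⟧-× (z ≤? b) (¬? (b ≤? z)) | ⟦⟧-× (a ≤? z) (z ≤? b)
                  | ⟦⟧-¬ (b ≤? z) =
      solve 4 (λ i j k m → (i :* j) :* (k :* m) := (i :* (j :* k)) :* m) refl
        ⟦ a ≤? z ⟧ ⟦ z ≤? b ⟧ (1ℤ + - ⟦ b ≤? z ⟧) (μ-fuel k a z)
  ... | yes _  | yes b≤a = contradiction b≤a b≰a
  ... | no a≰b | _       = contradiction a≤b a≰b

  μ-fuel-stable : ∀ {k k′} a b → #below b ℕ.< k → #below b ℕ.< k′ → μ-fuel k a b ≡ μ-fuel k′ a b
  μ-fuel-stable {ℕ.suc k} {ℕ.suc k′} a b b<k b<k′ = by-cases (a ≤? b) (b ≤? a)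
    where
    by-cases : Dec (a ≤ b) → Dec (b ≤ a) → μ-fuel (ℕ.suc k) a b ≡ μ-fuel (ℕ.suc k′) a b
    by-cases (no a≰b)  _         = trans (μ-fuel-≰ k a≰b) (sym (μ-fuel-≰ k′ a≰b))
    by-cases (yes a≤b) (yes b≤a) = trans (μ-fuel-≈ k a≤b b≤a) (sym (μ-fuel-≈ k′ a≤b b≤a))
    by-cases (yes a≤b) (no b≰a)  = begin
        μ-fuel (ℕ.suc k) a b               ≡⟨ μ-fuel-< k (a≤b , b≰a) ⟩
        - ΣL[ Ico? a b ] (μ-fuel k a)      ≡⟨ cong -_ (ΣL[]-congʳ (Ico? a b) (λ (_ , z<b) → μ-fuel-stable a _
                                                 (ℕ.<-≤-trans (#below-mono z<b) (ℕ.≤-pred b<k))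
                                                 (ℕ.<-≤-trans (#below-mono z<b) (ℕ.≤-pred b<k′)))) ⟩
        - ΣL[ Ico? a b ] (μ-fuel k′ a)     ≡⟨ μ-fuel-< k′ (a≤b , b≰a) ⟨
        μ-fuel (ℕ.suc k′) a b              ∎
      where open ≡-Reasoning

  μ₂≡μ-fuel : ∀ {k} a b → #below b ℕ.< k → μ₂ a b ≡ μ-fuel k a b
  μ₂≡μ-fuel a b = μ-fuel-stable a b (#below<length b)

  μ₂-≰ : ∀ {a b} → ¬ a ≤ b → μ₂ a b ≡ 0ℤ
  μ₂-≰ {a} {b} a≰b = trans (μ₂≡μ-fuel a b (ℕ.n<1+n _)) (μ-fuel-≰ _ a≰b)

  μ₂-≈ : ∀ {a b} → a ≤ b → b ≤ a → μ₂ a b ≡ 1ℤ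
  μ₂-≈ {a} {b} a≤b b≤a = trans (μ₂≡μ-fuel a b (ℕ.n<1+n _)) (μ-fuel-≈ _ a≤b b≤a)

  μ₂-< : ∀ {a b} → a < b → μ₂ a b ≡ - ΣL[ Ico? a b ] (μ₂ a)
  μ₂-< {a} {b} a<b = trans (μ₂≡μ-fuel a b (ℕ.n<1+n _)) (trans (μ-fuel-< _ a<b)
    (cong -_ (ΣL[]-congʳ (Ico? a b) (λ (_ , z<b) → sym (μ₂≡μ-fuel a _ (#below-mono z<b))))))

  μ₂-cong₂ : ∀ a {b b′} → b ≈ b′ → μ₂ a b ≡ μ₂ a b′
  μ₂-cong₂ a {b} {b′} b≈b′ = by-cases (a ≤? b) (b ≤? a)
    where
    b≤b′ : b ≤ b′
    b≤b′ = reflexive b≈b′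
    b′≤b : b′ ≤ b
    b′≤b = reflexive (Eq.sym b≈b′)
    by-cases : Dec (a ≤ b) → Dec (b ≤ a) → μ₂ a b ≡ μ₂ a b′
    by-cases (no a≰b)  _         = trans (μ₂-≰ a≰b) (sym (μ₂-≰ (λ a≤b′ → a≰b (≤-trans a≤b′ b′≤b))))
    by-cases (yes a≤b) (yes b≤a) = trans (μ₂-≈ a≤b b≤a) (sym (μ₂-≈ (≤-trans a≤b b≤b′) (≤-trans b′≤b b≤a)))
    by-cases (yes a≤b) (no b≰a)  =
      trans (μ₂-< (a≤b , b≰a))
        (trans (cong -_ (ΣL[]-congˡ (Ico? a b) (Ico? a b′)
                  (λ (a≤z , z≤b , b≰z) → a≤z , ≤-trans z≤b b≤b′ , λ b′≤z → b≰z (≤-trans b≤b′ b′≤z))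
                  (λ (a≤z , z≤b′ , b′≰z) → a≤z , ≤-trans z≤b′ b′≤b , λ b≤z → b′≰z (≤-trans b′≤b b≤z))
                  (μ₂ a)))
          (sym (μ₂-< (≤-trans a≤b b≤b′ , λ b′≤a → b≰a (≤-trans b≤b′ b′≤a)))))

  ΣL[Ico]-μ₂ : ∀ {a b} → a < b → ΣL[ Ico? a b ] (μ₂ a) ≡ - μ₂ a b
  ΣL[Ico]-μ₂ a<b = trans (sym (ℤ.neg-involutive _)) (cong -_ (sym (μ₂-< a<b)))

  ΣL[Icc]-μ₂ : ∀ {a b} → a < b → ΣL[ Icc? a b ] (μ₂ a) ≡ 0ℤ
  ΣL[Icc]-μ₂ {a} {b} a<b@(a≤b , _) = begin
      ΣL[ Icc? a b ] (μ₂ a)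
    ≡⟨ ΣL[]-split (Icc? a b) (b ≤?_) (μ₂ a) ⟩
      ΣL[ (λ z → Icc? a b z ×-dec ¬? (b ≤? z)) ] (μ₂ a) + ΣL[ (λ z → Icc? a b z ×-dec (b ≤? z)) ] (μ₂ a)
    ≡⟨ cong₂ _+_
         (ΣL[]-congˡ (λ z → Icc? a b z ×-dec ¬? (b ≤? z)) (Ico? a b) (λ ((a≤z , z≤b) , b≰z) → a≤z , z≤b , b≰z)
                                  (λ (a≤z , z≤b , b≰z) → (a≤z , z≤b) , b≰z) (μ₂ a))
         (ΣL[]-unique (λ z → Icc? a b z ×-dec (b ≤? z)) (λ ((_ , z≤b) , b≤z) → antisym z≤b b≤z)
                        (λ z≈b → (≤-trans a≤b (reflexive (Eq.sym z≈b)) , reflexive z≈b) , reflexive (Eq.sym z≈b))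
                        (μ₂ a) (μ₂-cong₂ a)) ⟩
      ΣL[ Ico? a b ] (μ₂ a) + μ₂ a b
    ≡⟨ cong (_+ μ₂ a b) (ΣL[Ico]-μ₂ a<b) ⟩
      - μ₂ a b + μ₂ a b
    ≡⟨ ℤ.+-inverseˡ (μ₂ a b) ⟩
      0ℤ
    ∎
    where open ≡-Reasoning

  leftModular-≤∨∧ : ∀ {x b y} → LeftModular x → b ≤ y → y ≤ b ∨ x → y ≤ b ∨ (x ∧ y)
  leftModular-≤∨∧ {x} {b} {y} x-leftModular b≤y y≤b∨x with b ≈? y
  ... | yes (_ , y≤b) = ≤-trans y≤b (x≤x∨y b (x ∧ y))
  ... | no b≉y        = ≤-trans (∧-greatest y≤b∨x ≤-refl)
    (reflexive (Eq.sym (x-leftModular y b b≤y (λ b≈y → b≉y (reflexive b≈y , reflexive (Eq.sym b≈y))))))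

  module _ (x : Carrier) where

    Disjoint : Pred Carrier 0ℓ
    Disjoint b = b ∧ x ≤ 0̂ × 0̂ ≤ b ∧ x

    Disjoint? : U.Decidable Disjoint
    Disjoint? b = (b ∧ x) ≈? 0̂

    Spanning : Carrier → Pred Carrier 0ℓ
    Spanning y b = Disjoint b × Icc b (b ∨ x) y

    Spanning? : ∀ y → U.Decidable (Spanning y)
    Spanning? y b = Disjoint? b ×-dec Icc? b (b ∨ x) y

    Disjoint⇒lowerBound≤0̂ : ∀ {b z} → Disjoint b → z ≤ b → z ≤ x → z ≤ 0̂
    Disjoint⇒lowerBound≤0̂ (b∧x≤0̂ , _) z≤b z≤x = ≤-trans (∧-greatest z≤b z≤x) b∧x≤0̂

    ΣL-μ₂-Icc-below : ∀ {b y} → Disjoint b → ¬ x ∧ y ≤ 0̂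
      → ΣL[ (λ c → Ico? 0̂ y c ×-dec Icc? b (b ∨ x) c) ] (μ₂ b) ≡ - (⟦ Icc? b (b ∨ x) y ⟧ * μ₂ b y)
    ΣL-μ₂-Icc-below {b} {y} b⊥x x∧y≰0̂ = by-cases (b ≤? y) (y ≤? (b ∨ x))
      where
      open ≡-Reasoning
      Ico∩Icc? : U.Decidable (λ c → Ico 0̂ y c × Icc b (b ∨ x) c)
      Ico∩Icc? c = Ico? 0̂ y c ×-dec Icc? b (b ∨ x) c

      by-cases : Dec (b ≤ y) → Dec (y ≤ b ∨ x) → ΣL[ Ico∩Icc? ] (μ₂ b) ≡ - (⟦ Icc? b (b ∨ x) y ⟧ * μ₂ b y)
      by-cases (no b≰y) _ = begin
          ΣL[ Ico∩Icc? ] (μ₂ b)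
        ≡⟨ ΣL[]-empty Ico∩Icc? (λ c ((_ , c≤y , _) , b≤c , _) → b≰y (≤-trans b≤c c≤y)) (μ₂ b) ⟩
          - (0ℤ * μ₂ b y)
        ≡⟨ cong (λ i → - (i * μ₂ b y)) (⟦⟧-no (Icc? b (b ∨ x) y) (b≰y ∘ proj₁)) ⟨
          - (⟦ Icc? b (b ∨ x) y ⟧ * μ₂ b y)
        ∎
      by-cases (yes b≤y) (yes y≤b∨x) = begin
          ΣL[ Ico∩Icc? ] (μ₂ b)
        ≡⟨ ΣL[]-congˡ Ico∩Icc? (Ico? b y) (λ ((_ , c<y) , b≤c , _) → b≤c , c<y)
             (λ (b≤c , c<y@(c≤y , _)) → (0̂-min _ , c<y) , b≤c , ≤-trans c≤y y≤b∨x) (μ₂ b) ⟩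
          ΣL[ Ico? b y ] (μ₂ b)
        ≡⟨ ΣL[Ico]-μ₂ (b≤y , λ y≤b → x∧y≰0̂ (Disjoint⇒lowerBound≤0̂ b⊥x (≤-trans (x∧y≤y x y) y≤b)
                                                                        (x∧y≤x x y))) ⟩
          - μ₂ b y
        ≡⟨ cong -_ (ℤ.*-identityˡ (μ₂ b y)) ⟨
          - (1ℤ * μ₂ b y)
        ≡⟨ cong (λ i → - (i * μ₂ b y)) (⟦⟧-yes (Icc? b (b ∨ x) y) (b≤y , y≤b∨x)) ⟨
          - (⟦ Icc? b (b ∨ x) y ⟧ * μ₂ b y)
        ∎
      by-cases (yes b≤y) (no y≰b∨x) = begin
          ΣL[ Ico∩Icc? ] (μ₂ b)
        ≡⟨ ΣL[]-congˡ Ico∩Icc? (Icc? b w) (λ ((_ , c≤y , _) , b≤c , c≤b∨x) → b≤c , ∧-greatest c≤b∨x c≤y)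
             (λ (b≤c , c≤w) → (0̂-min _ , ≤-trans c≤w (x∧y≤y _ _)
                                        , λ y≤c → y≰b∨x (≤-trans y≤c (≤-trans c≤w (x∧y≤x _ _))))
                              , b≤c , ≤-trans c≤w (x∧y≤x _ _)) (μ₂ b) ⟩
          ΣL[ Icc? b w ] (μ₂ b)
        ≡⟨ ΣL[Icc]-μ₂ (∧-greatest (x≤x∨y b x) b≤y
                       , λ w≤b → x∧y≰0̂ (Disjoint⇒lowerBound≤0̂ b⊥x (≤-trans x∧y≤w w≤b) (x∧y≤x x y))) ⟩
          - (0ℤ * μ₂ b y)
        ≡⟨ cong (λ i → - (i * μ₂ b y)) (⟦⟧-no (Icc? b (b ∨ x) y) (y≰b∨x ∘ proj₂)) ⟨
          - (⟦ Icc? b (b ∨ x) y ⟧ * μ₂ b y)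
        ∎
        where
        w : Carrier
        w = (b ∨ x) ∧ y
        x∧y≤w : x ∧ y ≤ w
        x∧y≤w = ∧-greatest (≤-trans (x∧y≤x x y) (y≤x∨y b x)) (x∧y≤y x y)

    μ-expansion-base : LeftModular x → ∀ {y} → x ∧ y ≤ 0̂ → ΣL[ Spanning? y ] (λ b → μ b * μ₂ b y) ≡ μ y
    μ-expansion-base x-leftModular {y} x∧y≤0̂ =
      trans (ΣL[]-unique (Spanning? y) spanning⇒≈y ≈y⇒spanning (λ b → μ b * μ₂ b y) summand-resp)
            (trans (cong (μ y *_) (μ₂-≈ ≤-refl ≤-refl)) (ℤ.*-identityʳ (μ y)))
      where
      spanning⇒≈y : ∀ {b} → Spanning y b → b ≈ y
      spanning⇒≈y {b} (_ , b≤y , y≤b∨x) = antisym b≤y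
        (≤-trans (leftModular-≤∨∧ x-leftModular b≤y y≤b∨x) (∨-least ≤-refl (≤-trans x∧y≤0̂ (0̂-min b))))

      ≈y⇒spanning : ∀ {b} → b ≈ y → Spanning y b
      ≈y⇒spanning {b} b≈y =
        (≤-trans (∧-greatest (x∧y≤y b x) (≤-trans (x∧y≤x b x) (reflexive b≈y))) x∧y≤0̂ , 0̂-min _)
        , reflexive b≈y , ≤-trans (reflexive (Eq.sym b≈y)) (x≤x∨y b x)

      summand-resp : ∀ {b} → b ≈ y → μ b * μ₂ b y ≡ μ y * μ₂ y y
      summand-resp b≈y = cong₂ _*_ (μ₂-cong₂ 0̂ b≈y)
        (trans (μ₂-≈ (reflexive b≈y) (reflexive (Eq.sym b≈y))) (sym (μ₂-≈ ≤-refl ≤-refl)))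

    μ-expansion-step : ∀ {y} → ¬ x ∧ y ≤ 0̂
      → (∀ {c} → c < y → μ c ≡ ΣL[ Spanning? c ] (λ b → μ b * μ₂ b c))
      → μ y ≡ ΣL[ Spanning? y ] (λ b → μ b * μ₂ b y)
    μ-expansion-step {y} x∧y≰0̂ IH = begin
        μ y
      ≡⟨ μ₂-< (0̂-min y , λ y≤0̂ → x∧y≰0̂ (≤-trans (x∧y≤y x y) y≤0̂)) ⟩
        - ΣL[ Ico? 0̂ y ] μ
      ≡⟨ cong -_ (ΣL[]-congʳ (Ico? 0̂ y) λ (_ , c<y) → trans (IH c<y) (sym (ΣL[]-× Disjoint? (I _) _))) ⟩
        - ΣL[ Ico? 0̂ y ] (λ c → ΣL[ Disjoint? ] (λ b → ⟦ I c b ⟧ * (μ b * μ₂ b c)))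
      ≡⟨ cong -_ (ΣL[]-swap (Ico? 0̂ y) Disjoint? _) ⟩
        - ΣL[ Disjoint? ] (λ b → ΣL[ Ico? 0̂ y ] (λ c → ⟦ I c b ⟧ * (μ b * μ₂ b c)))
      ≡⟨ cong -_ (ΣL[]-congʳ Disjoint? λ {b} _ → pull-out b) ⟩
        - ΣL[ Disjoint? ] (λ b → μ b * ΣL[ (λ c → Ico? 0̂ y c ×-dec I c b) ] (μ₂ b))
      ≡⟨ ΣL[]-neg Disjoint? _ ⟨
        ΣL[ Disjoint? ] (λ b → - (μ b * ΣL[ (λ c → Ico? 0̂ y c ×-dec I c b) ] (μ₂ b)))
      ≡⟨ ΣL[]-congʳ Disjoint? (λ {b} b⊥x → trans (ℤ.neg-distribʳ-* (μ b) _)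
           (trans (cong (λ s → μ b * - s) (ΣL-μ₂-Icc-below b⊥x x∧y≰0̂))
             (solve 3 (λ m i v → m :* (:- (:- (i :* v))) := i :* (m :* v)) refl
                (μ b) ⟦ I y b ⟧ (μ₂ b y)))) ⟩
        ΣL[ Disjoint? ] (λ b → ⟦ I y b ⟧ * (μ b * μ₂ b y))
      ≡⟨ ΣL[]-× Disjoint? (I y) (λ b → μ b * μ₂ b y) ⟩
        ΣL[ Spanning? y ] (λ b → μ b * μ₂ b y)
      ∎
      where
      open ≡-Reasoning
      I : ∀ c b → Dec (Icc b (b ∨ x) c)
      I c b = Icc? b (b ∨ x) c

      pull-out : ∀ b → ΣL[ Ico? 0̂ y ] (λ c → ⟦ I c b ⟧ * (μ b * μ₂ b c))
                     ≡ μ b * ΣL[ (λ c → Ico? 0̂ y c ×-dec I c b) ] (μ₂ b)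
      pull-out b = begin
          ΣL[ Ico? 0̂ y ] (λ c → ⟦ I c b ⟧ * (μ b * μ₂ b c))
        ≡⟨ ΣL[]-congʳ (Ico? 0̂ y) (λ {c} _ → solve 3 (λ i m v → i :* (m :* v) := m :* (i :* v)) refl
                                                  ⟦ I c b ⟧ (μ b) (μ₂ b c)) ⟩
          ΣL[ Ico? 0̂ y ] (λ c → μ b * (⟦ I c b ⟧ * μ₂ b c))
        ≡⟨ ΣL[]-*ˡ (Ico? 0̂ y) (μ b) _ ⟩
          μ b * ΣL[ Ico? 0̂ y ] (λ c → ⟦ I c b ⟧ * μ₂ b c)
        ≡⟨ cong (μ b *_) (ΣL[]-× (Ico? 0̂ y) (λ c → I c b) (μ₂ b)) ⟩
          μ b * ΣL[ (λ c → Ico? 0̂ y c ×-dec I c b) ] (μ₂ b)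
        ∎

    μ-expansion : LeftModular x → ∀ y → μ y ≡ ΣL[ Spanning? y ] (λ b → μ b * μ₂ b y)
    μ-expansion x-leftModular = WF.All.wfRec <-wellFounded 0ℓ Expansion step
      where
      Expansion : Pred Carrier 0ℓ
      Expansion y = μ y ≡ ΣL[ Spanning? y ] (λ b → μ b * μ₂ b y)

      step : ∀ y → (∀ {c} → c < y → Expansion c) → Expansion y
      step y IH with (x ∧ y) ≈? 0̂
      ... | yes (x∧y≤0̂ , _) = sym (μ-expansion-base x-leftModular x∧y≤0̂)
      ... | no x∧y≉0̂        = μ-expansion-step (λ x∧y≤0̂ → x∧y≉0̂ (x∧y≤0̂ , 0̂-min _)) IH

    Σμ-expansion : LeftModular x → (f : Carrier → ℤ)
      → ΣL (λ y → μ y * f y) ≡ ΣL[ Disjoint? ] (λ b → μ b * ΣL[ Icc? b (b ∨ x) ] (λ y → μ₂ b y * f y))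
    Σμ-expansion x-leftModular f = begin
        ΣL (λ y → μ y * f y)
      ≡⟨ sumList-cong elems expand ⟩
        ΣL (λ y → ΣL[ Disjoint? ] (λ b → ⟦ Icc? b (b ∨ x) y ⟧ * (μ b * (μ₂ b y * f y))))
      ≡⟨ ΣL-ΣL[]-swap Disjoint? (λ y b → ⟦ Icc? b (b ∨ x) y ⟧ * (μ b * (μ₂ b y * f y))) ⟩
        ΣL[ Disjoint? ] (λ b → ΣL[ Icc? b (b ∨ x) ] (λ y → μ b * (μ₂ b y * f y)))
      ≡⟨ ΣL[]-congʳ Disjoint? (λ {b} _ → ΣL[]-*ˡ (Icc? b (b ∨ x)) (μ b) (λ y → μ₂ b y * f y)) ⟩
        ΣL[ Disjoint? ] (λ b → μ b * ΣL[ Icc? b (b ∨ x) ] (λ y → μ₂ b y * f y))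
      ∎
      where
      open ≡-Reasoning
      expand : ∀ y → μ y * f y ≡ ΣL[ Disjoint? ] (λ b → ⟦ Icc? b (b ∨ x) y ⟧ * (μ b * (μ₂ b y * f y)))
      expand y = begin
          μ y * f y
        ≡⟨ cong (_* f y) (μ-expansion x-leftModular y) ⟩
          ΣL[ Spanning? y ] (λ b → μ b * μ₂ b y) * f y
        ≡⟨ ΣL[]-*ʳ (Spanning? y) (λ b → μ b * μ₂ b y) (f y) ⟩
          ΣL[ Spanning? y ] (λ b → μ b * μ₂ b y * f y)
        ≡⟨ ΣL[]-congʳ (Spanning? y) (λ {b} _ → ℤ.*-assoc (μ b) (μ₂ b y) (f y)) ⟩
          ΣL[ Spanning? y ] (λ b → μ b * (μ₂ b y * f y))
        ≡⟨ ΣL[]-× Disjoint? (λ b → Icc? b (b ∨ x) y) (λ b → μ b * (μ₂ b y * f y)) ⟨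
          ΣL[ Disjoint? ] (λ b → ⟦ Icc? b (b ∨ x) y ⟧ * (μ b * (μ₂ b y * f y)))
        ∎

lemma2p1 : (L : FiniteLattice) (G : AbelianGroup 0ℓ 0ℓ)
    → (_≟_ : Decidable (AbelianGroup._≈_ G))
    → (r : FiniteLattice.Carrier L → AbelianGroup.Carrier G)
    → (∀ {a b} → FiniteLattice._≈_ L a b → AbelianGroup._≈_ G (r a) (r b))
    → (n : AbelianGroup.Carrier G) (x : FiniteLattice.Carrier L)
    → FinLat.LeftModular L x
    → (e : AbelianGroup.Carrier G)
    → let open FiniteLattice L
          open FinLat L
          open AbelianGroup G
      in ΣL (λ y → μ y * ⟦ (n ∙ (r y) ⁻¹) ≟ e ⟧)
         ≡ ΣL (λ b → ⟦ (b ∧ x) ≈? 0̂ ⟧ * (μ b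
              * ΣL (λ y → ⟦ (b ≤? y) ×-dec (y ≤? (b ∨ x)) ⟧ * (μ₂ b y * ⟦ (n ∙ (r y) ⁻¹) ≟ e ⟧))))
-- The identity holds termwise in y, so r need not respect the lattice equality.
lemma2p1 L G _≟_ r _ n x x-leftModular e =
  Σμ-expansion L x x-leftModular (λ y → ⟦ (n ∙ r y ⁻¹) ≟ e ⟧)
  where open AbelianGroup G
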